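{- For a tile set $T$ that uniquely assembles an $n\times n$ square under temperature sequence $\{\tau_i\}_{i=1}^{k}$, for almost all $n$ it cannot be the case that both $|T| = o(\frac{\log n}{\log\log n})$ and $k=o(\log n)$.
   Context: Setting: the multiple temperature tile self-assembly model. A tile system consists of a tileset $T$ of four-sided Wang tiles with glue types, a seed tile $s\in T$, a glue function $G$ (with $G(x,y)=0$ for $x\neq y$), and, instead of a single temperature, a temperature sequence $\{\tau_i\}_{i=1}^{k}$ of positive integers. Assembly proceeds in $k$ phases starting from the seed: in phase $i$, any tile may attach at an empty position if the total glue strength with its neighbors is at least $\tau_i$, and any part of the supertile on the non-seed side of a cut of strength less than $\tau_i$ may be removed; each phase continues until no tile can be added or removed. The system uniquely assembles a shape if all phases always finish and the final terminal supertile is unique. $|T|$ is the tile complexity and $k$ is the temperature complexity. The temperature range (largest temperature in the sequence) is assumed to be bounded by a constant. "Almost all $n$" refers to a fraction of integers tending to 1 (arising from Kolmogorov complexity arguments). -}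

module Defs where

open import Data.Nat as ℕ using (ℕ; zero; suc; _≤_; _<_; _≟_)
open import Data.Nat.Logarithm using (⌊log₂_⌋)
open import Data.Integer as ℤ using (ℤ; +_)
open import Data.Fin using (Fin)
open import Data.Bool using (Bool; true; false; if_then_else_)
open import Data.Maybe using (Maybe; just; nothing)
open import Data.List using (List; []; _∷_; map; upTo; concatMap; length)
open import Data.Nat.ListAction using (sum)
open import Data.List.Relation.Unary.All using (All)
open import Data.List.Relation.Unary.Unique.Propositional using (Unique)
open import Data.Product using (_×_; _,_; Σ; ∃; ∃-syntax)
open import Data.Unit using (⊤)
open import Relation.Nullary using (¬_; yes; no)
open import Relation.Binary.PropositionalEquality using (_≡_; _≢_)
open import Relation.Binary.Construct.Closure.ReflexiveTransitive using (Star)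
open import Induction.WellFounded using (Acc)

record Tile : Set where
  constructor tile
  field
    north east south west : ℕ
open Tile public

glueStr : (ℕ → ℕ) → ℕ → ℕ → ℕ
glueStr G x y with x ≟ y
... | yes _ = G x
... | no  _ = 0

-- A multiple-temperature tile system.  The tile set is indexed by Fin t,
-- so the tile complexity |T| is t; the temperature sequence is a list,
-- the temperature complexity k is its length.
record TileSystem : Set where
  field
    t     : ℕ
    tiles : Fin t → Tile
    seed  : Fin t
    G     : ℕ → ℕ
    temps : List ℕ
open TileSystem public

Pos : Set
Pos = ℤ × ℤ

Config : ℕ → Set
Config t = Pos → Maybe (Fin t)

origin : Pos
origin = (+ 0 , + 0)

_⊕_ : Pos → Pos → Pos
(a , b) ⊕ (c , d) = (a ℤ.+ c , b ℤ.+ d)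

up right down left : Pos
up    = (+ 0 , + 1)
right = (+ 1 , + 0)
down  = (+ 0 , ℤ.- (+ 1))
left  = (ℤ.- (+ 1) , + 0)

module _ (𝒯 : TileSystem) where
  private
    T = tiles 𝒯
    g = G 𝒯

  seedConfig : Config (t 𝒯)
  seedConfig p with ℤ._≟_ (Data.Product.proj₁ p) (+ 0) | ℤ._≟_ (Data.Product.proj₂ p) (+ 0)
  ... | yes _ | yes _ = just (seed 𝒯)
  ... | _     | _     = nothing

  bondR : Config (t 𝒯) → Pos → ℕ
  bondR A p with A p | A (p ⊕ right)
  ... | just a | just b = glueStr g (east (T a)) (west (T b))
  ... | _      | _      = 0

  bondU : Config (t 𝒯) → Pos → ℕ
  bondU A p with A p | A (p ⊕ up)
  ... | just a | just b = glueStr g (north (T a)) (south (T b))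
  ... | _      | _      = 0

  attachStr : Config (t 𝒯) → Pos → Fin (t 𝒯) → ℕ
  attachStr A p x = nb (p ⊕ up) (λ y → glueStr g (north (T x)) (south (T y)))
              ℕ.+ nb (p ⊕ right) (λ y → glueStr g (east (T x)) (west (T y)))
              ℕ.+ nb (p ⊕ down) (λ y → glueStr g (south (T x)) (north (T y)))
              ℕ.+ nb (p ⊕ left) (λ y → glueStr g (west (T x)) (east (T y)))
    where
    nb : Pos → (Fin (t 𝒯) → ℕ) → ℕ
    nb q f with A q
    ... | just y  = f y
    ... | nothing = 0

  Bounded : ℕ → Config (t 𝒯) → Set
  Bounded B A = ∀ (p : Pos) → A p ≢ nothing →
    (ℤ.- (+ B) ℤ.≤ Data.Product.proj₁ p) × (Data.Product.proj₁ p ℤ.≤ + B) ×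
    (ℤ.- (+ B) ℤ.≤ Data.Product.proj₂ p) × (Data.Product.proj₂ p ℤ.≤ + B)

  range : ℕ → List ℤ
  range B = map (λ i → + i ℤ.- + B) (upTo (suc (B ℕ.+ B)))

  box : ℕ → List Pos
  box B = concatMap (λ x → map (λ y → (x , y)) (range B)) (range B)

  crossing : (Pos → Bool) → Pos → Pos → ℕ → ℕ
  crossing S p q s with S p | S q
  ... | true  | false = s
  ... | false | true  = s
  ... | _     | _     = 0

  -- strength of the cut (S , complement of S) of a configuration
  -- contained in the box [-B,B]² (all bonds have an endpoint in the box)
  cutStr : ℕ → Config (t 𝒯) → (Pos → Bool) → ℕ
  cutStr B A S = sum (map (λ p → crossing S p (p ⊕ right) (bondR A p)
                            ℕ.+ crossing S p (p ⊕ up) (bondU A p)) (box B))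

  data Step (τ : ℕ) (A A' : Config (t 𝒯)) : Set where
    add : (p : Pos) (x : Fin (t 𝒯)) →
          A p ≡ nothing → τ ≤ attachStr A p x →
          A' p ≡ just x → (∀ q → q ≢ p → A' q ≡ A q) →
          Step τ A A'
    remove : (S : Pos → Bool) (B : ℕ) →
          Bounded B A →
          S origin ≡ false →
          (∃[ q ] (S q ≡ true × A q ≢ nothing)) →
          cutStr B A S < τ →
          (∀ q → A' q ≡ (if S q then nothing else A q)) →
          Step τ A A'

  Terminal : ℕ → Config (t 𝒯) → Set
  Terminal τ A = ∀ A' → ¬ Step τ A A'

  Final : Config (t 𝒯) → List ℕ → Config (t 𝒯) → Set
  Final A []       A' = ∀ p → A' p ≡ A p
  Final A (τ ∷ τs) A' = ∃[ B ] (Star (Step τ) A B × Terminal τ B × Final B τs A')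

  AlwaysFinish : Config (t 𝒯) → List ℕ → Set
  AlwaysFinish A []       = ⊤
  AlwaysFinish A (τ ∷ τs) =
    Acc (λ C D → Step τ D C) A ×
    (∀ B → Star (Step τ) A B → Terminal τ B → AlwaysFinish B τs)

  IsSquare : ℕ → Config (t 𝒯) → Set
  IsSquare n A = ∃[ a ] ∃[ b ] ∀ (p : Pos) →
    (A p ≢ nothing → InSq a b p) × (InSq a b p → A p ≢ nothing)
    where
    InSq : ℤ → ℤ → Pos → Set
    InSq a b (x , y) = (a ℤ.≤ x) × (x ℤ.< a ℤ.+ + n) × (b ℤ.≤ y) × (y ℤ.< b ℤ.+ + n)

  UniquelyAssemblesSquare : ℕ → Set
  UniquelyAssemblesSquare n =
    AlwaysFinish seedConfig (temps 𝒯) ×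
    (∃[ A ] (Final seedConfig (temps 𝒯) A × IsSquare n A)) ×
    (∀ A A' → Final seedConfig (temps 𝒯) A → Final seedConfig (temps 𝒯) A' →
       ∀ p → A p ≡ A' p)

-- f n = o(log n / log log n)  (floor logs base 2; base is irrelevant)
LittleO-logOverLoglog : (ℕ → ℕ) → Set
LittleO-logOverLoglog f = ∀ (c : ℕ) → ∃[ N ] ∀ n → N ≤ n →
  c ℕ.* f n ℕ.* ⌊log₂ ⌊log₂ n ⌋ ⌋ ≤ ⌊log₂ n ⌋

LittleO-log : (ℕ → ℕ) → Set
LittleO-log f = ∀ (c : ℕ) → ∃[ N ] ∀ n → N ≤ n → c ℕ.* f n ≤ ⌊log₂ n ⌋

DensityZero : (ℕ → Set) → Set
DensityZero P = ∀ (c : ℕ) → ∃[ M ] ∀ m → M ≤ m →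
  ∀ (xs : List ℕ) → Unique xs → All (λ n → n ≤ m × P n) xs →
  c ℕ.* length xs ≤ m

module Submission where

-- Assembly at temperatures τ ≤ R compares bond strengths only with τ, so strengths matter only up
-- to R, and glue types matter only through which of them coincide. Hence a system with t tiles and
-- k temperatures in [1, R] assembles exactly like any other system with the same seed, the same
-- temperatures and, glue occurrence by glue occurrence, the same label (the index < 4t of the first
-- occurrence of that glue) and the same strength capped at R. Written as a numeral, these data are
-- below 2 ^ O(t log t + k), and since the assembled square is unique, equal codes force equal sizes.
-- If t = o(log n / log log n) and k = o(log n), then t log t + k = o(log n), so at most
-- m ^ o(1) + O(1) sizes n ≤ m are assembled by such systems: a set of density zero.

open import Defs

open import Data.Bool using (true; false; if_then_else_)
open import Data.Fin as Fin using (Fin; zero; suc; toℕ)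
import Data.Fin.Properties as Fin
open import Data.Integer as ℤ using (+_)
import Data.Integer.Properties as ℤ
open import Data.List as List using (List; []; _∷_; _++_; map; length)
open import Data.List.Membership.Propositional using (_∈_)
open import Data.List.Membership.Propositional.Properties using (∈-lookup)
open import Data.List.Membership.Setoid.Properties using (index-injective)
open import Data.List.Properties using (map-cong; map-injective; length-map; ∷-injectiveˡ; ∷-injectiveʳ)
open import Data.List.Relation.Binary.Pointwise as Pointwise using (Pointwise; []; _∷_)
open import Data.List.Relation.Binary.Subset.Propositional using (_⊆_)
open import Data.List.Relation.Binary.Subset.Propositional.Properties using (⊆-trans; xs⊆xs++ys; xs⊆ys++xs)
open import Data.List.Relation.Unary.All as All using (All; []; _∷_)
import Data.List.Relation.Unary.All.Properties as All
open import Data.List.Relation.Unary.AllPairs using (_∷_)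
open import Data.List.Relation.Unary.Any using (index; here; there)
open import Data.List.Relation.Unary.Unique.Propositional using (Unique)
open import Data.Maybe using (just; nothing)
open import Data.Nat
  using (ℕ; zero; suc; _+_; _*_; _^_; _⊓_; _⊔_; ⌊_/2⌋; ⌈_/2⌉; _≤_; _<_; _≤?_; _<?_; _≟_; z≤n; s≤s; z<s; >-nonZero)
open import Data.List.Membership.DecPropositional _≟_ using (_∈?_)
open import Data.Nat.ListAction using (sum)
open import Data.Nat.Logarithm using (⌊log₂_⌋; ⌊log₂⌋-mono-≤; ⌊log₂[2^n]⌋≡n)
open import Data.Nat.Logarithm.Core using (⌊log2⌋)
open import Data.Nat.Properties
open import Data.Nat.Tactic.RingSolver using (solve)
open import Data.Product using (_×_; _,_; proj₁; proj₂; ∃-syntax)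
open import Data.Sum using (_⊎_; inj₁; inj₂)
open import Function using (_∘_; _⇔_; mk⇔; Equivalence)
open import Induction.WellFounded using (Acc; acc)
open import Relation.Binary.Construct.Closure.ReflexiveTransitive as Star using (ε; _◅_)
open import Relation.Binary.Definitions using (tri<; tri≈; tri>)
open import Relation.Binary.PropositionalEquality
open import Relation.Nullary using (Dec; yes; no; contradiction)
open import Relation.Unary using (Decidable)

tileSystem : (t : ℕ) → (Fin t → Tile) → Fin t → (ℕ → ℕ) → List ℕ → TileSystem
tileSystem t T s G τs = record { t = t ; tiles = T ; seed = s ; G = G ; temps = τs }

-- Agreement up to a threshold

infix 4 _≈[_]_
_≈[_]_ : ℕ → ℕ → ℕ → Set
x ≈[ R ] y = x ⊓ R ≡ y ⊓ R

+-⊓-absorb : ∀ R a b → (a + b) ⊓ R ≡ (a ⊓ R + b ⊓ R) ⊓ R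
+-⊓-absorb R a b with ≤-total R a | ≤-total R b
... | inj₁ R≤a | _ rewrite m≥n⇒m⊓n≡n R≤a =
  trans (m≥n⇒m⊓n≡n (≤-trans R≤a (m≤m+n a b))) (sym (m≥n⇒m⊓n≡n (m≤m+n R (b ⊓ R))))
... | inj₂ _ | inj₁ R≤b rewrite m≥n⇒m⊓n≡n R≤b =
  trans (m≥n⇒m⊓n≡n (≤-trans R≤b (m≤n+m b a))) (sym (m≥n⇒m⊓n≡n (m≤n+m R (a ⊓ R))))
... | inj₂ a≤R | inj₂ b≤R rewrite m≤n⇒m⊓n≡m a≤R | m≤n⇒m⊓n≡m b≤R = refl

≈-+ : ∀ {R a a′ b b′} → a ≈[ R ] a′ → b ≈[ R ] b′ → a + b ≈[ R ] a′ + b′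
≈-+ {R} {a} {a′} {b} {b′} a≈a′ b≈b′ = begin
  (a + b) ⊓ R               ≡⟨ +-⊓-absorb R a b ⟩
  (a ⊓ R + b ⊓ R) ⊓ R       ≡⟨ cong₂ (λ x y → (x + y) ⊓ R) a≈a′ b≈b′ ⟩
  (a′ ⊓ R + b′ ⊓ R) ⊓ R     ≡⟨ +-⊓-absorb R a′ b′ ⟨
  (a′ + b′) ⊓ R             ∎
  where open ≡-Reasoning

≈-sum : ∀ {R} {A : Set} (f g : A → ℕ) (xs : List A) → (∀ x → f x ≈[ R ] g x) → sum (map f xs) ≈[ R ] sum (map g xs)
≈-sum f g []       f≈g = refl
≈-sum f g (x ∷ xs) f≈g = ≈-+ (f≈g x) (≈-sum f g xs f≈g)

≤-resp-≈ : ∀ {R τ x y} → τ ≤ R → x ≈[ R ] y → τ ≤ x → τ ≤ y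
≤-resp-≈ {R} {y = y} τ≤R x≈y τ≤x = ≤-trans (≤-trans (⊓-glb τ≤x τ≤R) (≤-reflexive x≈y)) (m⊓n≤m y R)

<-resp-≈ : ∀ {R τ x y} → τ ≤ R → x ≈[ R ] y → x < τ → y < τ
<-resp-≈ τ≤R x≈y x<τ = ≰⇒> (<⇒≱ x<τ ∘ ≤-resp-≈ τ≤R (sym x≈y))

glueStr-comm : ∀ G a b → glueStr G a b ≡ glueStr G b a
glueStr-comm G a b with a ≟ b | b ≟ a
... | yes refl | yes _    = refl
... | yes refl | no b≢a   = contradiction refl b≢a
... | no a≢b   | yes refl = contradiction refl a≢b
... | no _     | no _     = refl

glueStr-≈ : ∀ {R G₁ G₂ a₁ b₁ a₂ b₂} → (a₁ ≡ b₁ ⇔ a₂ ≡ b₂) → G₁ a₁ ≈[ R ] G₂ a₂ →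
            glueStr G₁ a₁ b₁ ≈[ R ] glueStr G₂ a₂ b₂
glueStr-≈ {a₁ = a₁} {b₁} {a₂} {b₂} same G≈ with a₁ ≟ b₁ | a₂ ≟ b₂
... | yes _     | yes _     = G≈
... | yes a₁≡b₁ | no a₂≢b₂  = contradiction (Equivalence.to same a₁≡b₁) a₂≢b₂
... | no a₁≢b₁  | yes a₂≡b₂ = contradiction (Equivalence.from same a₂≡b₂) a₁≢b₁
... | no _      | no _      = refl

-- Simulation of one tile system by another

module _ (𝒯 : TileSystem) {A A₀ : Config (t 𝒯)} (A≗A₀ : A ≗ A₀) where

  attachStr-cong : ∀ p x → attachStr 𝒯 A p x ≡ attachStr 𝒯 A₀ p x
  attachStr-cong p x rewrite A≗A₀ (p ⊕ up) | A≗A₀ (p ⊕ right) | A≗A₀ (p ⊕ down) | A≗A₀ (p ⊕ left) = refl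

  cutStr-cong : ∀ B S → cutStr 𝒯 B A S ≡ cutStr 𝒯 B A₀ S
  cutStr-cong B S = cong sum (map-cong bonds (box 𝒯 B))
    where
    bonds : ∀ p → crossing 𝒯 S p (p ⊕ right) (bondR 𝒯 A p) + crossing 𝒯 S p (p ⊕ up) (bondU 𝒯 A p)
                ≡ crossing 𝒯 S p (p ⊕ right) (bondR 𝒯 A₀ p) + crossing 𝒯 S p (p ⊕ up) (bondU 𝒯 A₀ p)
    bonds p rewrite A≗A₀ p | A≗A₀ (p ⊕ right) | A≗A₀ (p ⊕ up) = refl

  Step-cong : ∀ {τ A′} → Step 𝒯 τ A A′ → Step 𝒯 τ A₀ A′
  Step-cong {τ} (add p x empty strong placed others) =
    add p x (trans (sym (A≗A₀ p)) empty) (subst (τ ≤_) (attachStr-cong p x) strong) placed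
        (λ q q≢p → trans (others q q≢p) (A≗A₀ q))
  Step-cong {τ} (remove S B bounded seedSide (q , Sq , occupied) weak removed) =
    remove S B (λ p A₀p≢nothing → bounded p (A₀p≢nothing ∘ trans (sym (A≗A₀ p)))) seedSide
           (q , Sq , occupied ∘ trans (A≗A₀ q))
           (subst (_< τ) (cutStr-cong B S) weak)
           (λ q → trans (removed q) (cong (if S q then nothing else_) (A≗A₀ q)))

record BondsAgree (R : ℕ) {t} (T₁ : Fin t → Tile) (G₁ : ℕ → ℕ) (T₂ : Fin t → Tile) (G₂ : ℕ → ℕ) : Set where
  field
    east-west   : ∀ x y → glueStr G₁ (east (T₁ x)) (west (T₁ y)) ≈[ R ] glueStr G₂ (east (T₂ x)) (west (T₂ y))
    north-south : ∀ x y → glueStr G₁ (north (T₁ x)) (south (T₁ y)) ≈[ R ] glueStr G₂ (north (T₂ x)) (south (T₂ y))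

  west-east : ∀ x y → glueStr G₁ (west (T₁ y)) (east (T₁ x)) ≈[ R ] glueStr G₂ (west (T₂ y)) (east (T₂ x))
  west-east x y rewrite glueStr-comm G₁ (west (T₁ y)) (east (T₁ x)) | glueStr-comm G₂ (west (T₂ y)) (east (T₂ x)) =
    east-west x y

  south-north : ∀ x y → glueStr G₁ (south (T₁ y)) (north (T₁ x)) ≈[ R ] glueStr G₂ (south (T₂ y)) (north (T₂ x))
  south-north x y rewrite glueStr-comm G₁ (south (T₁ y)) (north (T₁ x)) | glueStr-comm G₂ (south (T₂ y)) (north (T₂ x)) =
    north-south x y

open BondsAgree

BondsAgree-sym : ∀ {R t} {T₁ T₂ : Fin t → Tile} {G₁ G₂} → BondsAgree R T₁ G₁ T₂ G₂ → BondsAgree R T₂ G₂ T₁ G₁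
BondsAgree-sym agree = record
  { east-west   = λ x y → sym (east-west agree x y)
  ; north-south = λ x y → sym (north-south agree x y)
  }

module _ {R t} {T₁ T₂ : Fin t → Tile} {G₁ G₂} (agree : BondsAgree R T₁ G₁ T₂ G₂) {s : Fin t} {τs : List ℕ} where

  private
    𝒯₁ 𝒯₂ : TileSystem
    𝒯₁ = tileSystem t T₁ s G₁ τs
    𝒯₂ = tileSystem t T₂ s G₂ τs
    infixl 6 _⊹_
    _⊹_ : ∀ {a a′ b b′} → a ≈[ R ] a′ → b ≈[ R ] b′ → a + b ≈[ R ] a′ + b′
    _⊹_ = ≈-+

  -- An empty neighbour in front contributes 0 + …, which reduces away, so it gets no summand.
  attachStr-≈ : ∀ (A : Config t) p x → attachStr 𝒯₁ A p x ≈[ R ] attachStr 𝒯₂ A p x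
  attachStr-≈ A p x with A (p ⊕ up) | A (p ⊕ right) | A (p ⊕ down) | A (p ⊕ left)
  ... | nothing | nothing | nothing | nothing = refl
  ... | nothing | nothing | nothing | just d  = west-east agree d x
  ... | nothing | nothing | just c  | nothing = south-north agree c x ⊹ refl
  ... | nothing | nothing | just c  | just d  = south-north agree c x ⊹ west-east agree d x
  ... | nothing | just b  | nothing | nothing = east-west agree x b ⊹ refl ⊹ refl
  ... | nothing | just b  | nothing | just d  = east-west agree x b ⊹ refl ⊹ west-east agree d x
  ... | nothing | just b  | just c  | nothing = east-west agree x b ⊹ south-north agree c x ⊹ refl
  ... | nothing | just b  | just c  | just d  = east-west agree x b ⊹ south-north agree c x ⊹ west-east agree d x
  ... | just a  | nothing | nothing | nothing = north-south agree x a ⊹ refl ⊹ refl ⊹ refl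
  ... | just a  | nothing | nothing | just d  = north-south agree x a ⊹ refl ⊹ refl ⊹ west-east agree d x
  ... | just a  | nothing | just c  | nothing = north-south agree x a ⊹ refl ⊹ south-north agree c x ⊹ refl
  ... | just a  | nothing | just c  | just d  = north-south agree x a ⊹ refl ⊹ south-north agree c x ⊹ west-east agree d x
  ... | just a  | just b  | nothing | nothing = north-south agree x a ⊹ east-west agree x b ⊹ refl ⊹ refl
  ... | just a  | just b  | nothing | just d  = north-south agree x a ⊹ east-west agree x b ⊹ refl ⊹ west-east agree d x
  ... | just a  | just b  | just c  | nothing = north-south agree x a ⊹ east-west agree x b ⊹ south-north agree c x ⊹ refl
  ... | just a  | just b  | just c  | just d  = north-south agree x a ⊹ east-west agree x b ⊹ south-north agree c x ⊹ west-east agree d x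

  bondR-≈ : ∀ (A : Config t) p → bondR 𝒯₁ A p ≈[ R ] bondR 𝒯₂ A p
  bondR-≈ A p with A p | A (p ⊕ right)
  ... | just a  | just b  = east-west agree a b
  ... | just _  | nothing = refl
  ... | nothing | _       = refl

  bondU-≈ : ∀ (A : Config t) p → bondU 𝒯₁ A p ≈[ R ] bondU 𝒯₂ A p
  bondU-≈ A p with A p | A (p ⊕ up)
  ... | just a  | just b  = north-south agree a b
  ... | just _  | nothing = refl
  ... | nothing | _       = refl

  crossing-≈ : ∀ S p q {a b} → a ≈[ R ] b → crossing 𝒯₁ S p q a ≈[ R ] crossing 𝒯₂ S p q b
  crossing-≈ S p q a≈b with S p | S q
  ... | true  | true  = refl
  ... | true  | false = a≈b
  ... | false | true  = a≈b
  ... | false | false = refl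

  cutStr-≈ : ∀ B (A : Config t) S → cutStr 𝒯₁ B A S ≈[ R ] cutStr 𝒯₂ B A S
  cutStr-≈ B A S = ≈-sum _ _ (box 𝒯₁ B) λ p →
    crossing-≈ S p (p ⊕ right) (bondR-≈ A p) ⊹ crossing-≈ S p (p ⊕ up) (bondU-≈ A p)

  Step-transfer : ∀ {τ A A′} → τ ≤ R → Step 𝒯₁ τ A A′ → Step 𝒯₂ τ A A′
  Step-transfer {A = A} τ≤R (add p x empty strong placed others) =
    add p x empty (≤-resp-≈ τ≤R (attachStr-≈ A p x) strong) placed others
  Step-transfer {A = A} τ≤R (remove S B bounded seedSide nonempty weak removed) =
    remove S B bounded seedSide nonempty (<-resp-≈ τ≤R (cutStr-≈ B A S) weak) removed

module _ {R t} {T₁ T₂ : Fin t → Tile} {G₁ G₂} (agree : BondsAgree R T₁ G₁ T₂ G₂) {s : Fin t} {τs : List ℕ} where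

  private
    𝒯₁ 𝒯₂ : TileSystem
    𝒯₁ = tileSystem t T₁ s G₁ τs
    𝒯₂ = tileSystem t T₂ s G₂ τs

  Terminal-transfer : ∀ {τ B B₀} → τ ≤ R → B ≗ B₀ → Terminal 𝒯₁ τ B → Terminal 𝒯₂ τ B₀
  Terminal-transfer τ≤R B≗B₀ terminal A′ step =
    terminal A′ (Step-transfer (BondsAgree-sym agree) τ≤R (Step-cong 𝒯₂ (sym ∘ B≗B₀) step))

  Final-transfer : ∀ {A A₀ A′} ts → All (_≤ R) ts → A ≗ A₀ → Final 𝒯₁ A ts A′ → Final 𝒯₂ A₀ ts A′
  Final-transfer [] [] A≗A₀ A′≗A = λ p → trans (A′≗A p) (A≗A₀ p)
  Final-transfer (τ ∷ ts) (τ≤R ∷ ts≤R) A≗A₀ (_ , ε , terminal , final) =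
    _ , ε , Terminal-transfer τ≤R A≗A₀ terminal , Final-transfer ts ts≤R A≗A₀ final
  Final-transfer (τ ∷ ts) (τ≤R ∷ ts≤R) A≗A₀ (B , step ◅ steps , terminal , final) =
    B , Step-cong 𝒯₂ A≗A₀ (Step-transfer agree τ≤R step) ◅ Star.map (Step-transfer agree τ≤R) steps ,
    Terminal-transfer τ≤R (λ _ → refl) terminal , Final-transfer ts ts≤R (λ _ → refl) final

seedConfig-cong : ∀ {t T₁ T₂ s G₁ G₂ τs₁ τs₂} →
  seedConfig (tileSystem t T₁ s G₁ τs₁) ≗ seedConfig (tileSystem t T₂ s G₂ τs₂)
seedConfig-cong (x , y) with x ℤ.≟ + 0 | y ℤ.≟ + 0
... | yes _ | yes _ = refl
... | yes _ | no _  = refl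
... | no _  | _     = refl

module _ (𝒯 : TileSystem) where

  IsSquare-cong : ∀ {n A A₀} → A ≗ A₀ → IsSquare 𝒯 n A → IsSquare 𝒯 n A₀
  IsSquare-cong A≗A₀ (a , b , square) = a , b , λ p →
    (λ occupied → proj₁ (square p) (occupied ∘ trans (sym (A≗A₀ p)))) ,
    (λ inside A₀p≡nothing → proj₂ (square p) inside (trans (A≗A₀ p) A₀p≡nothing))

  private
    offset : ∀ a {k n} → k < n → a ℤ.≤ a ℤ.+ + k × a ℤ.+ + k ℤ.< a ℤ.+ + n
    offset a {k} k<n = ℤ.i≤i+j a (+ k) , ℤ.+-monoʳ-< a (ℤ.+<+ k<n)

  IsSquare-size≤ : ∀ {n n′ A} → IsSquare 𝒯 n A → IsSquare 𝒯 n′ A → n′ ≤ n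
  IsSquare-size≤ {n′ = zero} _ _ = z≤n
  IsSquare-size≤ {n} {suc k} {A} (a , b , square) (a′ , b′ , square′) =
    ≰⇒> λ n≤k → ℤ.<⇒≱ far-corner< (ℤ.≤-trans (ℤ.+-monoʳ-≤ a (ℤ.+≤+ n≤k)) (ℤ.+-monoˡ-≤ (+ k) a≤a′))
    where
    occupied : ∀ {i} → i < suc k → A (a′ ℤ.+ + i , b′ ℤ.+ + 0) ≢ nothing
    occupied i<n′ = let x≥ , x< = offset a′ i<n′ ; y≥ , y< = offset b′ z<s in
                    proj₂ (square′ _) (x≥ , x< , y≥ , y<)
    a≤a′ : a ℤ.≤ a′
    a≤a′ = subst (a ℤ.≤_) (ℤ.+-identityʳ a′) (proj₁ (proj₁ (square _) (occupied z<s)))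
    far-corner< : a′ ℤ.+ + k ℤ.< a ℤ.+ + n
    far-corner< = proj₁ (proj₂ (proj₁ (square _) (occupied ≤-refl)))

  IsSquare-size-unique : ∀ {n n′ A} → IsSquare 𝒯 n A → IsSquare 𝒯 n′ A → n ≡ n′
  IsSquare-size-unique square square′ = ≤-antisym (IsSquare-size≤ square′ square) (IsSquare-size≤ square square′)

BondsAgree⇒same-size : ∀ {R t T₁ T₂ G₁ G₂ s τs n₁ n₂} → BondsAgree R T₁ G₁ T₂ G₂ → All (_≤ R) τs →
  UniquelyAssemblesSquare (tileSystem t T₁ s G₁ τs) n₁ → UniquelyAssemblesSquare (tileSystem t T₂ s G₂ τs) n₂ →
  n₁ ≡ n₂
BondsAgree⇒same-size {t = t} {T₁} {T₂} {G₁} {G₂} {s} {τs} agree τs≤R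
  (_ , (A₁ , final₁ , square₁) , _) (_ , (A₂ , final₂ , square₂) , unique₂) =
  IsSquare-size-unique 𝒯₂ square₁ (IsSquare-cong 𝒯₂ (unique₂ A₂ A₁ final₂ final₁′) square₂)
  where
  𝒯₂ : TileSystem
  𝒯₂ = tileSystem t T₂ s G₂ τs
  final₁′ : Final 𝒯₂ (seedConfig 𝒯₂) τs A₁
  final₁′ = Final-transfer agree τs τs≤R seedConfig-cong final₁

-- Coding tile systems

pair-< : ∀ {a b B C} → a < B → b < C → a + B * b < B * C
pair-< {a} {b} {B} a<B b<C = begin-strict
  a + B * b    <⟨ +-monoˡ-< (B * b) a<B ⟩
  B + B * b    ≡⟨ *-suc B b ⟨
  B * suc b    ≤⟨ *-monoʳ-≤ B b<C ⟩
  _            ∎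
  where open ≤-Reasoning

pair-injective : ∀ {a a′ b b′ B} → a < B → a′ < B → a + B * b ≡ a′ + B * b′ → a ≡ a′ × b ≡ b′
pair-injective {a} {a′} {b} {b′} {B} a<B a′<B eq with <-cmp b b′
... | tri≈ _ refl _ = +-cancelʳ-≡ (B * b) a a′ eq , refl
... | tri< b<b′ _ _ = contradiction eq (<⇒≢ (<-≤-trans (pair-< a<B b<b′) (m≤n+m (B * b′) a′)))
... | tri> _ _ b′<b = contradiction (sym eq) (<⇒≢ (<-≤-trans (pair-< a′<B b′<b) (m≤n+m (B * b) a)))

fromDigits : ℕ → List ℕ → ℕ
fromDigits b []       = 0
fromDigits b (d ∷ ds) = d + b * fromDigits b ds

fromDigits-< : ∀ {b} ds → All (_< b) ds → fromDigits b ds < b ^ length ds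
fromDigits-< []       []           = z<s
fromDigits-< (d ∷ ds) (d<b ∷ ds<b) = pair-< d<b (fromDigits-< ds ds<b)

-- Nonzero digits make the numeral determine the length of the digit list.
fromDigits-injective : ∀ {b} ds es → All (λ d → 1 ≤ d × d ≤ b) ds → All (λ e → 1 ≤ e × e ≤ b) es →
                       fromDigits (suc b) ds ≡ fromDigits (suc b) es → ds ≡ es
fromDigits-injective []       []       _                  _                  _  = refl
fromDigits-injective []       (e ∷ es) _                  ((1≤e , _) ∷ _)    eq =
  contradiction eq (<⇒≢ (≤-trans 1≤e (m≤m+n e _)))
fromDigits-injective (d ∷ ds) []       ((1≤d , _) ∷ _)    _                  eq =
  contradiction (sym eq) (<⇒≢ (≤-trans 1≤d (m≤m+n d _)))
fromDigits-injective (d ∷ ds) (e ∷ es) ((_ , d≤b) ∷ ds⁺) ((_ , e≤b) ∷ es⁺) eq =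
  let d≡e , rest≡ = pair-injective (s≤s d≤b) (s≤s e≤b) eq
  in cong₂ _∷_ d≡e (fromDigits-injective ds es ds⁺ es⁺ rest≡)

sides : Tile → List ℕ
sides tl = north tl ∷ east tl ∷ south tl ∷ west tl ∷ []

glues : ∀ {n} → (Fin n → Tile) → List ℕ
glues {zero}  T = []
glues {suc n} T = sides (T zero) ++ glues (T ∘ suc)

length-glues : ∀ {n} (T : Fin n → Tile) → length (glues T) ≡ 4 * n
length-glues {zero}  T = refl
length-glues {suc n} T = trans (cong (λ k → 4 + k) (length-glues (T ∘ suc))) (sym (*-suc 4 n))

sides⊆glues : ∀ {n} (T : Fin n → Tile) x → sides (T x) ⊆ glues T
sides⊆glues T zero    = xs⊆xs++ys _ _
sides⊆glues T (suc x) = ⊆-trans (sides⊆glues (T ∘ suc) x) (xs⊆ys++xs _ (sides (T zero)))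

record SidesMatch (_~_ : ℕ → ℕ → Set) (tl₁ tl₂ : Tile) : Set where
  field
    north~ : north tl₁ ~ north tl₂
    east~  : east tl₁ ~ east tl₂
    south~ : south tl₁ ~ south tl₂
    west~  : west tl₁ ~ west tl₂

glues-Pointwise⇒SidesMatch : ∀ {n} {T₁ T₂ : Fin n → Tile} {_~_ : ℕ → ℕ → Set} →
  Pointwise _~_ (glues T₁) (glues T₂) → ∀ x → SidesMatch _~_ (T₁ x) (T₂ x)
glues-Pointwise⇒SidesMatch (n~ ∷ e~ ∷ s~ ∷ w~ ∷ _)  zero    = record { north~ = n~ ; east~ = e~ ; south~ = s~ ; west~ = w~ }
glues-Pointwise⇒SidesMatch (_ ∷ _ ∷ _ ∷ _ ∷ rest~) (suc x) = glues-Pointwise⇒SidesMatch rest~ x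

-- Junk value 0 when a ∉ L.
firstIndex : List ℕ → ℕ → ℕ
firstIndex L a with a ∈? L
... | yes a∈L = toℕ (index a∈L)
... | no _    = 0

firstIndex-< : ∀ {L a} → a ∈ L → firstIndex L a < length L
firstIndex-< {L} {a} a∈L with a ∈? L
... | yes p  = Fin.toℕ<n (index p)
... | no a∉L = contradiction a∈L a∉L

firstIndex-injective : ∀ {L a b} → a ∈ L → b ∈ L → firstIndex L a ≡ firstIndex L b → a ≡ b
firstIndex-injective {L} {a} {b} a∈L b∈L eq with a ∈? L | b ∈? L
... | yes p  | yes q  = index-injective (setoid ℕ) p q (Fin.toℕ-injective eq)
... | no a∉L | _      = contradiction a∈L a∉L
... | yes _  | no b∉L = contradiction b∈L b∉L

module _ (R : ℕ) where

  glueDigit : (ℕ → ℕ) → List ℕ → ℕ → ℕ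
  glueDigit G L a = G a ⊓ R + suc R * firstIndex L a

  digits : TileSystem → List ℕ
  digits 𝒯 = t 𝒯 ∷ toℕ (seed 𝒯) ∷ map (glueDigit (G 𝒯) (glues (tiles 𝒯))) (glues (tiles 𝒯))

  glueDigit-bond : ∀ {G₁ G₂ L₁ L₂ a₁ b₁ a₂ b₂} → a₁ ∈ L₁ → b₁ ∈ L₁ → a₂ ∈ L₂ → b₂ ∈ L₂ →
    glueDigit G₁ L₁ a₁ ≡ glueDigit G₂ L₂ a₂ → glueDigit G₁ L₁ b₁ ≡ glueDigit G₂ L₂ b₂ →
    glueStr G₁ a₁ b₁ ≈[ R ] glueStr G₂ a₂ b₂
  glueDigit-bond {G₁} {G₂} {L₁} {L₂} {a₁} {b₁} {a₂} {b₂} a₁∈ b₁∈ a₂∈ b₂∈ a-digits b-digits =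
    glueStr-≈ same-glue a-strength
    where
    capped : ∀ G a → G a ⊓ R < suc R
    capped G a = s≤s (m⊓n≤n (G a) R)
    a-strength : G₁ a₁ ≈[ R ] G₂ a₂
    a-strength = proj₁ (pair-injective (capped G₁ a₁) (capped G₂ a₂) a-digits)
    a-index : firstIndex L₁ a₁ ≡ firstIndex L₂ a₂
    a-index = proj₂ (pair-injective (capped G₁ a₁) (capped G₂ a₂) a-digits)
    b-index : firstIndex L₁ b₁ ≡ firstIndex L₂ b₂
    b-index = proj₂ (pair-injective (capped G₁ b₁) (capped G₂ b₂) b-digits)
    same-glue : a₁ ≡ b₁ ⇔ a₂ ≡ b₂
    same-glue = mk⇔
      (λ a₁≡b₁ → firstIndex-injective a₂∈ b₂∈ (trans (sym a-index) (trans (cong (firstIndex L₁) a₁≡b₁) b-index)))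
      (λ a₂≡b₂ → firstIndex-injective a₁∈ b₁∈ (trans a-index (trans (cong (firstIndex L₂) a₂≡b₂) (sym b-index))))

  glueDigits-agree : ∀ {t} {T₁ T₂ : Fin t → Tile} {G₁ G₂} →
    map (glueDigit G₁ (glues T₁)) (glues T₁) ≡ map (glueDigit G₂ (glues T₂)) (glues T₂) → BondsAgree R T₁ G₁ T₂ G₂
  glueDigits-agree {T₁ = T₁} {T₂} {G₁} {G₂} same = record
    { east-west   = λ x y → glueDigit-bond (east∈ T₁ x) (west∈ T₁ y) (east∈ T₂ x) (west∈ T₂ y)
                                            (east~ (match x)) (west~ (match y))
    ; north-south = λ x y → glueDigit-bond (north∈ T₁ x) (south∈ T₁ y) (north∈ T₂ x) (south∈ T₂ y)
                                            (north~ (match x)) (south~ (match y))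
    }
    where
    open SidesMatch
    match : ∀ x → SidesMatch (λ a₁ a₂ → glueDigit G₁ (glues T₁) a₁ ≡ glueDigit G₂ (glues T₂) a₂) (T₁ x) (T₂ x)
    match = glues-Pointwise⇒SidesMatch (Pointwise.map⁻ _ _ (Pointwise.≡⇒Pointwise-≡ same))
    north∈ : ∀ {n} (T : Fin n → Tile) x → north (T x) ∈ glues T
    north∈ T x = sides⊆glues T x (here refl)
    east∈ : ∀ {n} (T : Fin n → Tile) x → east (T x) ∈ glues T
    east∈ T x = sides⊆glues T x (there (here refl))
    south∈ : ∀ {n} (T : Fin n → Tile) x → south (T x) ∈ glues T
    south∈ T x = sides⊆glues T x (there (there (here refl)))
    west∈ : ∀ {n} (T : Fin n → Tile) x → west (T x) ∈ glues T
    west∈ T x = sides⊆glues T x (there (there (there (here refl))))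

  digits-determine-size : ∀ {𝒯₁ 𝒯₂ n₁ n₂} → digits 𝒯₁ ≡ digits 𝒯₂ → temps 𝒯₁ ≡ temps 𝒯₂ →
    All (_≤ R) (temps 𝒯₁) → UniquelyAssemblesSquare 𝒯₁ n₁ → UniquelyAssemblesSquare 𝒯₂ n₂ → n₁ ≡ n₂
  digits-determine-size {record { t = t ; tiles = T₁ ; seed = s₁ ; G = G₁ ; temps = τs }}
                        {record { t = t₂ ; tiles = T₂ ; seed = s₂ ; G = G₂ ; temps = _ }} same refl
    with refl ← ∷-injectiveˡ same
    with refl ← Fin.toℕ-injective (∷-injectiveˡ (∷-injectiveʳ same))
    = BondsAgree⇒same-size (glueDigits-agree (∷-injectiveʳ (∷-injectiveʳ same)))

-- Counting

n<2^n : ∀ n → n < 2 ^ n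
n<2^n zero    = z<s
n<2^n (suc n) = begin-strict
  suc n           ≤⟨ n<2^n n ⟩
  2 ^ n           <⟨ m<m+n (2 ^ n) (m^n>0 2 n) ⟩
  2 ^ n + 2 ^ n   ≡⟨ cong (λ x → 2 ^ n + x) (+-identityʳ (2 ^ n)) ⟨
  2 ^ suc n       ∎
  where open ≤-Reasoning

2^⌊log2⌋≤n : ∀ n (rec : Acc _<_ (suc n)) → 2 ^ ⌊log2⌋ (suc n) rec ≤ suc n
2^⌊log2⌋≤n zero    _        = ≤-refl
2^⌊log2⌋≤n (suc k) (acc _)  = begin
  2 * 2 ^ ⌊log2⌋ (suc h) _   ≤⟨ *-monoʳ-≤ 2 (2^⌊log2⌋≤n h _) ⟩
  2 * suc h                   ≡⟨ *-suc 2 h ⟩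
  2 + 2 * h                   ≤⟨ +-monoʳ-≤ 2 twice-half≤ ⟩
  2 + k                       ∎
  where
  open ≤-Reasoning
  h : ℕ
  h = ⌊ k /2⌋
  twice-half≤ : 2 * h ≤ k
  twice-half≤ = begin
    2 * h           ≡⟨ cong (λ x → h + x) (+-identityʳ h) ⟩
    h + h           ≤⟨ +-monoʳ-≤ h (⌊n/2⌋≤⌈n/2⌉ k) ⟩
    h + ⌈ k /2⌉     ≡⟨ ⌊n/2⌋+⌈n/2⌉≡n k ⟩
    k               ∎

2^⌊log₂n⌋≤n : ∀ n → 1 ≤ n → 2 ^ ⌊log₂ n ⌋ ≤ n
2^⌊log₂n⌋≤n (suc n) _ = 2^⌊log2⌋≤n n _

2^j≤n⇒j≤⌊log₂n⌋ : ∀ {j n} → 2 ^ j ≤ n → j ≤ ⌊log₂ n ⌋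
2^j≤n⇒j≤⌊log₂n⌋ {j} 2^j≤n = subst (_≤ _) (⌊log₂[2^n]⌋≡n j) (⌊log₂⌋-mono-≤ 2^j≤n)

n<2^[1+⌊log₂n⌋] : ∀ n → n < 2 ^ suc ⌊log₂ n ⌋
n<2^[1+⌊log₂n⌋] n = ≰⇒> λ 2^l+1≤n → <-irrefl refl (2^j≤n⇒j≤⌊log₂n⌋ 2^l+1≤n)

⌊log₂n⌋≤n*⌊log₂n⌋ : ∀ n → ⌊log₂ n ⌋ ≤ n * ⌊log₂ n ⌋
⌊log₂n⌋≤n*⌊log₂n⌋ zero    = z≤n
⌊log₂n⌋≤n*⌊log₂n⌋ (suc n) = m≤m+n _ _

n≤1+n*⌊log₂n⌋ : ∀ n → n ≤ 1 + n * ⌊log₂ n ⌋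
n≤1+n*⌊log₂n⌋ n with ⌊log₂ n ⌋ | n<2^[1+⌊log₂n⌋] n
... | zero  | n<2 = ≤-trans (≤-pred n<2) (s≤s z≤n)
... | suc l | _   = m≤n⇒m≤1+n (m≤m*n n (suc l))

x≤2^a⇒x^n≤2^[a*n] : ∀ {x} a n → x ≤ 2 ^ a → x ^ n ≤ 2 ^ (a * n)
x≤2^a⇒x^n≤2^[a*n] a n x≤2^a = ≤-trans (^-monoˡ-≤ n x≤2^a) (≤-reflexive (^-*-assoc 2 a n))

exponent≤ : ∀ R l T K u → 1 ≤ u → l ≤ u → T ≤ u → T * l ≤ u → K ≤ u →
            (R + (3 + l)) * (2 + 4 * T) + R * K ≤ (24 + 7 * R) * u
exponent≤ R l T K u 1≤u l≤u T≤u Tl≤u K≤u = begin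
  (R + (3 + l)) * (2 + 4 * T) + R * K
    ≡⟨ solve (R List.∷ l List.∷ T List.∷ K List.∷ List.[]) ⟩
  (2 * R + 6) * 1 + 2 * l + (4 * R + 12) * T + 4 * (T * l) + R * K
    ≤⟨ +-mono-≤ (+-mono-≤ (+-mono-≤ (+-mono-≤ (*-monoʳ-≤ (2 * R + 6) 1≤u) (*-monoʳ-≤ 2 l≤u))
                                     (*-monoʳ-≤ (4 * R + 12) T≤u)) (*-monoʳ-≤ 4 Tl≤u)) (*-monoʳ-≤ R K≤u) ⟩
  (2 * R + 6) * u + 2 * u + (4 * R + 12) * u + 4 * u + R * u
    ≡⟨ solve (R List.∷ u List.∷ List.[]) ⟩
  (24 + 7 * R) * u ∎
  where open ≤-Reasoning

module Code (R T K : ℕ) where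

  D : ℕ
  D = suc (suc R * (4 * T))

  record Good (𝒯 : TileSystem) : Set where
    field
      few-tiles        : t 𝒯 ≤ T
      few-temperatures : length (temps 𝒯) ≤ K
      temperatures≤R   : All (λ τ → 1 ≤ τ × τ ≤ R) (temps 𝒯)

  -- Shifted by one: fromDigits-injective needs nonzero digits.
  systemCode : TileSystem → ℕ
  systemCode 𝒯 = fromDigits (suc D) (map suc (digits R 𝒯))

  code : TileSystem → ℕ
  code 𝒯 = systemCode 𝒯 + suc D ^ (2 + 4 * T) * fromDigits (suc R) (temps 𝒯)

  Count : ℕ
  Count = suc D ^ (2 + 4 * T) * suc R ^ K

  digits-< : ∀ 𝒯 → t 𝒯 ≤ T → All (_< D) (digits R 𝒯)
  digits-< 𝒯 t≤T =
    t<D ∷ <-trans (Fin.toℕ<n (seed 𝒯)) t<D ∷ All.map⁺ {f = glueDigit R (G 𝒯) (glues (tiles 𝒯))} (All.tabulate glueDigit<)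
    where
    4t≤ : 4 * t 𝒯 ≤ suc R * (4 * T)
    4t≤ = ≤-trans (*-monoʳ-≤ 4 t≤T) (m≤n*m (4 * T) (suc R))
    t<D : t 𝒯 < D
    t<D = s≤s (≤-trans (m≤n*m (t 𝒯) 4) 4t≤)
    glueDigit< : ∀ {a} → a ∈ glues (tiles 𝒯) → glueDigit R (G 𝒯) (glues (tiles 𝒯)) a < D
    glueDigit< {a} a∈ = m<n⇒m<1+n (pair-< (s≤s (m⊓n≤n (G 𝒯 a) R))
      (<-≤-trans (firstIndex-< a∈) (≤-trans (≤-reflexive (length-glues (tiles 𝒯))) (*-monoʳ-≤ 4 t≤T))))

  shifted-digits : ∀ 𝒯 → t 𝒯 ≤ T → All (λ d → 1 ≤ d × d ≤ D) (map suc (digits R 𝒯))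
  shifted-digits 𝒯 t≤T = All.map⁺ (All.map (λ d<D → s≤s z≤n , d<D) (digits-< 𝒯 t≤T))

  systemCode-< : ∀ 𝒯 → t 𝒯 ≤ T → systemCode 𝒯 < suc D ^ (2 + 4 * T)
  systemCode-< 𝒯 t≤T =
    <-≤-trans (fromDigits-< _ (All.map (s≤s ∘ proj₂) (shifted-digits 𝒯 t≤T))) (^-monoʳ-≤ (suc D) length≤)
    where
    length≤ : length (map suc (digits R 𝒯)) ≤ 2 + 4 * T
    length≤ = begin
      length (map suc (digits R 𝒯))            ≡⟨ length-map suc (digits R 𝒯) ⟩
      2 + length (map _ (glues (tiles 𝒯)))      ≡⟨ cong (λ n → 2 + n) (length-map _ (glues (tiles 𝒯))) ⟩
      2 + length (glues (tiles 𝒯))              ≡⟨ cong (λ n → 2 + n) (length-glues (tiles 𝒯)) ⟩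
      2 + 4 * t 𝒯                               ≤⟨ +-monoʳ-≤ 2 (*-monoʳ-≤ 4 t≤T) ⟩
      2 + 4 * T                                 ∎
      where open ≤-Reasoning

  code-< : ∀ {𝒯} → Good 𝒯 → code 𝒯 < Count
  code-< {𝒯} record { few-tiles = t≤T ; few-temperatures = k≤K ; temperatures≤R = τs≤R } =
    pair-< (systemCode-< 𝒯 t≤T)
           (<-≤-trans (fromDigits-< _ (All.map (s≤s ∘ proj₂) τs≤R)) (^-monoʳ-≤ (suc R) k≤K))

  code-determines-size : ∀ {𝒯₁ 𝒯₂ n₁ n₂} → Good 𝒯₁ → Good 𝒯₂ → code 𝒯₁ ≡ code 𝒯₂ →
    UniquelyAssemblesSquare 𝒯₁ n₁ → UniquelyAssemblesSquare 𝒯₂ n₂ → n₁ ≡ n₂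
  code-determines-size {𝒯₁} {𝒯₂} good₁ good₂ same =
    digits-determine-size R {𝒯₁} {𝒯₂}
      (map-injective suc-injective (fromDigits-injective _ _ (shifted-digits 𝒯₁ t₁≤T) (shifted-digits 𝒯₂ t₂≤T) same-system))
      (fromDigits-injective _ _ τs₁≤R τs₂≤R same-temps)
      (All.map proj₂ τs₁≤R)
    where
    open Good good₁ renaming (few-tiles to t₁≤T; temperatures≤R to τs₁≤R)
    open Good good₂ renaming (few-tiles to t₂≤T; temperatures≤R to τs₂≤R)
    same-system : systemCode 𝒯₁ ≡ systemCode 𝒯₂
    same-system = proj₁ (pair-injective (systemCode-< 𝒯₁ t₁≤T) (systemCode-< 𝒯₂ t₂≤T) same)
    same-temps : fromDigits (suc R) (temps 𝒯₁) ≡ fromDigits (suc R) (temps 𝒯₂)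
    same-temps = proj₂ (pair-injective (systemCode-< 𝒯₁ t₁≤T) (systemCode-< 𝒯₂ t₂≤T) same)

  private
    l : ℕ
    l = ⌊log₂ T ⌋

  base≤ : suc D ≤ 2 ^ (R + (3 + l))
  base≤ = begin
    2 + suc R * (4 * T)          ≤⟨ +-monoˡ-≤ (suc R * (4 * T)) (m≤n*m 2 (suc R)) ⟩
    suc R * 2 + suc R * (4 * T)  ≡⟨ *-distribˡ-+ (suc R) 2 (4 * T) ⟨
    suc R * (2 + 4 * T)          ≤⟨ *-mono-≤ (n<2^n R) 2+4T≤ ⟩
    2 ^ R * 2 ^ (3 + l)          ≡⟨ ^-distribˡ-+-* 2 R (3 + l) ⟨
    2 ^ (R + (3 + l))            ∎
    where
    open ≤-Reasoning
    2+4T≤ : 2 + 4 * T ≤ 2 ^ (3 + l)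
    2+4T≤ = begin
      2 + 4 * T        ≤⟨ m≤n+m (2 + 4 * T) 2 ⟩
      4 + 4 * T        ≡⟨ *-suc 4 T ⟨
      4 * suc T        ≤⟨ *-monoʳ-≤ 4 (n<2^[1+⌊log₂n⌋] T) ⟩
      4 * 2 ^ suc l    ≡⟨ *-assoc 2 2 (2 ^ suc l) ⟩
      2 ^ (3 + l)      ∎

  Count≤ : Count ≤ 2 ^ ((24 + 7 * R) * (1 + T * l + K))
  Count≤ = begin
    suc D ^ (2 + 4 * T) * suc R ^ K
      ≤⟨ *-mono-≤ (x≤2^a⇒x^n≤2^[a*n] (R + (3 + l)) (2 + 4 * T) base≤) (x≤2^a⇒x^n≤2^[a*n] R K (n<2^n R)) ⟩
    2 ^ ((R + (3 + l)) * (2 + 4 * T)) * 2 ^ (R * K)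
      ≡⟨ ^-distribˡ-+-* 2 ((R + (3 + l)) * (2 + 4 * T)) (R * K) ⟨
    2 ^ ((R + (3 + l)) * (2 + 4 * T) + R * K)
      ≤⟨ ^-monoʳ-≤ 2 (exponent≤ R l T K u (s≤s z≤n) l≤u T≤u Tl≤u K≤u) ⟩
    2 ^ ((24 + 7 * R) * u) ∎
    where
    open ≤-Reasoning
    u : ℕ
    u = 1 + T * l + K
    Tl≤u : T * l ≤ u
    Tl≤u = ≤-trans (m≤m+n (T * l) K) (n≤1+n _)
    K≤u : K ≤ u
    K≤u = ≤-trans (m≤n+m K (T * l)) (n≤1+n _)
    l≤u : l ≤ u
    l≤u = ≤-trans (⌊log₂n⌋≤n*⌊log₂n⌋ T) Tl≤u
    T≤u : T ≤ u
    T≤u = ≤-trans (n≤1+n*⌊log₂n⌋ T) (s≤s (m≤m+n (T * l) K))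

module _ {P : ℕ → Set} (P? : Decidable P) where

  -- 0 when no i ≤ j satisfies P.
  greatest : ℕ → ℕ
  greatest zero    = 0
  greatest (suc j) with P? (suc j)
  ... | yes _ = suc j
  ... | no  _ = greatest j

  greatest-satisfies : P 0 → ∀ j → P (greatest j)
  greatest-satisfies P0 zero    = P0
  greatest-satisfies P0 (suc j) with P? (suc j)
  ... | yes Pj = Pj
  ... | no  _  = greatest-satisfies P0 j

  greatest-maximal : ∀ {i} j → i ≤ j → P i → i ≤ greatest j
  greatest-maximal zero    i≤0 _  = i≤0
  greatest-maximal (suc j) i≤j Pi with P? (suc j)
  ... | yes _ = i≤j
  ... | no ¬Pj with m≤n⇒m<n∨m≡n i≤j
  ...   | inj₁ i<1+j = greatest-maximal j (≤-pred i<1+j) Pi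
  ...   | inj₂ refl  = contradiction Pi ¬Pj

lookup-injective : ∀ {A : Set} {xs : List A} → Unique xs → ∀ {i j} → List.lookup xs i ≡ List.lookup xs j → i ≡ j
lookup-injective (_ ∷ _)      {zero}  {zero}  _  = refl
lookup-injective (x∉xs ∷ _)   {zero}  {suc j} eq = contradiction eq (All.lookup x∉xs (∈-lookup j))
lookup-injective (x∉xs ∷ _)   {suc i} {zero}  eq = contradiction (sym eq) (All.lookup x∉xs (∈-lookup i))
lookup-injective (_ ∷ unique) {suc i} {suc j} eq = cong suc (lookup-injective unique eq)

length≤-by-key : ∀ {A : Set} {xs : List A} {B} → Unique xs → (key : ∀ {x} → x ∈ xs → ℕ) →
  (∀ {x} (x∈ : x ∈ xs) → key x∈ < B) → (∀ {x y} (x∈ : x ∈ xs) (y∈ : y ∈ xs) → key x∈ ≡ key y∈ → x ≡ y) →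
  length xs ≤ B
length≤-by-key {xs = xs} {B} unique key key<B key-injective with B <? length xs
... | no B≮length = ≮⇒≥ B≮length
... | yes B<length =
  let i , j , i<j , same = Fin.pigeonhole B<length code in contradiction (code-injective same) (Fin.<⇒≢ i<j)
  where
  code : Fin (length xs) → Fin B
  code i = Fin.fromℕ< (key<B (∈-lookup i))
  code-injective : ∀ {i j} → code i ≡ code j → i ≡ j
  code-injective {i} {j} same = lookup-injective unique (key-injective (∈-lookup i) (∈-lookup j)
    (trans (sym (Fin.toℕ-fromℕ< (key<B (∈-lookup i)))) (trans (cong toℕ same) (Fin.toℕ-fromℕ< (key<B (∈-lookup j))))))

-- Sparseness

EfficientlyAssembled : ℕ → (ℕ → ℕ) → (ℕ → ℕ) → ℕ → Set
EfficientlyAssembled R f g n = ∃[ 𝒯 ] (All (λ τ → 1 ≤ τ × τ ≤ R) (temps 𝒯) × UniquelyAssemblesSquare 𝒯 n ×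
                                       t 𝒯 ≤ f n × length (temps 𝒯) ≤ g n)

m⊔n≤o⇒m≤o×n≤o : ∀ {m n o} → m ⊔ n ≤ o → m ≤ o × n ≤ o
m⊔n≤o⇒m≤o×n≤o {m} {n} m⊔n≤o = m⊔n≤o⇒m≤o m n m⊔n≤o , m⊔n≤o⇒n≤o m n m⊔n≤o

exponent-budget : ∀ c a X K ℓ → 4 * (a * X) ≤ ℓ → 4 * (a * K) ≤ ℓ → 2 * (2 * c + a) ≤ ℓ →
                  2 * c + a * (1 + X + K) ≤ ℓ
exponent-budget c a X K ℓ aX≤ aK≤ ca≤ = *-cancelˡ-≤ 4 (begin
  4 * (2 * c + a * (1 + X + K))                        ≡⟨ solve (c List.∷ a List.∷ X List.∷ K List.∷ List.[]) ⟩
  2 * (2 * (2 * c + a)) + 4 * (a * X) + 4 * (a * K)    ≤⟨ +-mono-≤ (+-mono-≤ (*-monoʳ-≤ 2 ca≤) aX≤) aK≤ ⟩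
  2 * ℓ + ℓ + ℓ                                        ≡⟨ solve (ℓ List.∷ List.[]) ⟩
  4 * ℓ                                                ∎)
  where open ≤-Reasoning

module Sparse (R : ℕ) {f g : ℕ → ℕ} (hf : LittleO-logOverLoglog f) (hg : LittleO-log g) where

  A : ℕ
  A = 24 + 7 * R

  eventually-small : ∃[ N ] ∀ {n t k} → N ≤ n → t ≤ f n → k ≤ g n →
    t ≤ ⌊log₂ n ⌋ × 4 * (A * (t * ⌊log₂ t ⌋)) ≤ ⌊log₂ n ⌋ × 4 * (A * k) ≤ ⌊log₂ n ⌋
  eventually-small = 4 ⊔ (N₁ ⊔ (N₄ ⊔ Ng)) , λ N≤n →
    let 4≤n , N′≤n = m⊔n≤o⇒m≤o×n≤o N≤n
        N₁≤n , N″≤n = m⊔n≤o⇒m≤o×n≤o N′≤n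
        N₄≤n , Ng≤n = m⊔n≤o⇒m≤o×n≤o N″≤n
    in small 4≤n N₁≤n N₄≤n Ng≤n
    where
    N₁ N₄ Ng : ℕ
    N₁ = proj₁ (hf 1)
    N₄ = proj₁ (hf (4 * A))
    Ng = proj₁ (hg (4 * A))
    small : ∀ {n t k} → 4 ≤ n → N₁ ≤ n → N₄ ≤ n → Ng ≤ n → t ≤ f n → k ≤ g n →
      t ≤ ⌊log₂ n ⌋ × 4 * (A * (t * ⌊log₂ t ⌋)) ≤ ⌊log₂ n ⌋ × 4 * (A * k) ≤ ⌊log₂ n ⌋
    small {n} {t} {k} 4≤n N₁≤n N₄≤n Ng≤n t≤fn k≤gn = t≤ln , tlogt≤ , k≤
      where
      open ≤-Reasoning
      ln lln : ℕ
      ln = ⌊log₂ n ⌋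
      lln = ⌊log₂ ln ⌋
      1≤lln : 1 ≤ lln
      1≤lln = 2^j≤n⇒j≤⌊log₂n⌋ (2^j≤n⇒j≤⌊log₂n⌋ {2} 4≤n)
      t≤ln : t ≤ ln
      t≤ln = begin
        t             ≤⟨ t≤fn ⟩
        f n           ≤⟨ m≤m*n (f n) lln {{>-nonZero 1≤lln}} ⟩
        f n * lln     ≡⟨ cong (_* lln) (*-identityˡ (f n)) ⟨
        1 * f n * lln ≤⟨ proj₂ (hf 1) n N₁≤n ⟩
        ln            ∎
      tlogt≤ : 4 * (A * (t * ⌊log₂ t ⌋)) ≤ ln
      tlogt≤ = begin
        4 * (A * (t * ⌊log₂ t ⌋))  ≡⟨ *-assoc 4 A (t * ⌊log₂ t ⌋) ⟨
        4 * A * (t * ⌊log₂ t ⌋)    ≤⟨ *-monoʳ-≤ (4 * A) (*-mono-≤ t≤fn (⌊log₂⌋-mono-≤ t≤ln)) ⟩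
        4 * A * (f n * lln)        ≡⟨ *-assoc (4 * A) (f n) lln ⟨
        4 * A * f n * lln          ≤⟨ proj₂ (hf (4 * A)) n N₄≤n ⟩
        ln                         ∎
      k≤ : 4 * (A * k) ≤ ln
      k≤ = begin
        4 * (A * k)    ≡⟨ *-assoc 4 A k ⟨
        4 * A * k      ≤⟨ *-monoʳ-≤ (4 * A) k≤gn ⟩
        4 * A * g n    ≤⟨ proj₂ (hg (4 * A)) n Ng≤n ⟩
        ln             ∎

  N : ℕ
  N = proj₁ eventually-small

  module AtScale (m : ℕ) where

    ℓ : ℕ
    ℓ = ⌊log₂ m ⌋

    T-fits? : Decidable (λ x → 4 * (A * (x * ⌊log₂ x ⌋)) ≤ ℓ)
    T-fits? x = 4 * (A * (x * ⌊log₂ x ⌋)) ≤? ℓ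

    K-fits? : Decidable (λ x → 4 * (A * x) ≤ ℓ)
    K-fits? x = 4 * (A * x) ≤? ℓ

    -- The largest tile and temperature counts whose share of the code exponent is ≤ ℓ / 4.
    T K : ℕ
    T = greatest T-fits? ℓ
    K = greatest K-fits? ℓ

    open Code R T K

    efficient⇒Good : ∀ {n 𝒯} → N ≤ n → n ≤ m → All (λ τ → 1 ≤ τ × τ ≤ R) (temps 𝒯) →
                     t 𝒯 ≤ f n → length (temps 𝒯) ≤ g n → Good 𝒯
    efficient⇒Good {n} {𝒯} N≤n n≤m τs-ok t≤fn k≤gn = record
      { few-tiles        = greatest-maximal T-fits? ℓ (≤-trans t≤ln ln≤ℓ) (≤-trans tlogt≤ ln≤ℓ)
      ; few-temperatures = greatest-maximal K-fits? ℓ (≤-trans k≤4Ak (≤-trans k≤ ln≤ℓ)) (≤-trans k≤ ln≤ℓ)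
      ; temperatures≤R   = τs-ok
      }
      where
      k : ℕ
      k = length (temps 𝒯)
      ln≤ℓ : ⌊log₂ n ⌋ ≤ ℓ
      ln≤ℓ = ⌊log₂⌋-mono-≤ n≤m
      small : t 𝒯 ≤ ⌊log₂ n ⌋ × 4 * (A * (t 𝒯 * ⌊log₂ t 𝒯 ⌋)) ≤ ⌊log₂ n ⌋ × 4 * (A * k) ≤ ⌊log₂ n ⌋
      small = proj₂ eventually-small N≤n t≤fn k≤gn
      t≤ln : t 𝒯 ≤ ⌊log₂ n ⌋
      t≤ln = proj₁ small
      tlogt≤ : 4 * (A * (t 𝒯 * ⌊log₂ t 𝒯 ⌋)) ≤ ⌊log₂ n ⌋
      tlogt≤ = proj₁ (proj₂ small)
      k≤ : 4 * (A * k) ≤ ⌊log₂ n ⌋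
      k≤ = proj₂ (proj₂ small)
      k≤4Ak : k ≤ 4 * (A * k)
      k≤4Ak = ≤-trans (m≤n*m k A) (m≤n*m (A * k) 4)

    CodeFor : ℕ → ℕ → Set
    CodeFor n k = (n < N × k ≡ n) ⊎ (∃[ 𝒯 ] Good 𝒯 × UniquelyAssemblesSquare 𝒯 n × k ≡ N + code 𝒯)

    CodeFor-unique : ∀ {n n′ k} → CodeFor n k → CodeFor n′ k → n ≡ n′
    CodeFor-unique (inj₁ (_ , refl)) (inj₁ (_ , refl)) = refl
    CodeFor-unique (inj₁ (n<N , refl)) (inj₂ (𝒯 , _ , _ , refl)) = contradiction (m≤m+n N (code 𝒯)) (<⇒≱ n<N)
    CodeFor-unique (inj₂ (𝒯 , _ , _ , refl)) (inj₁ (n<N , refl)) = contradiction (m≤m+n N (code 𝒯)) (<⇒≱ n<N)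
    CodeFor-unique (inj₂ (𝒯₁ , good₁ , square₁ , refl)) (inj₂ (𝒯₂ , good₂ , square₂ , same)) =
      code-determines-size good₁ good₂ (+-cancelˡ-≡ N _ _ same) square₁ square₂

    codeFor : ∀ {n} → n ≤ m → EfficientlyAssembled R f g n → ∃[ k ] k < N + Count × CodeFor n k
    codeFor {n} n≤m (𝒯 , τs-ok , square , t≤fn , k≤gn) = by-size (n <? N)
      where
      by-size : Dec (n < N) → ∃[ k ] k < N + Count × CodeFor n k
      by-size (yes n<N) = n , <-≤-trans n<N (m≤m+n N Count) , inj₁ (n<N , refl)
      by-size (no n≮N)  = N + code 𝒯 , +-monoʳ-< N (code-< good) , inj₂ (𝒯 , good , square , refl)
        where
        good : Good 𝒯
        good = efficient⇒Good (≮⇒≥ n≮N) n≤m τs-ok t≤fn k≤gn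

    few-sizes : ∀ {xs} → Unique xs → All (λ n → n ≤ m × EfficientlyAssembled R f g n) xs → length xs ≤ N + Count
    few-sizes {xs} unique members = length≤-by-key unique (proj₁ ∘ coded) (proj₁ ∘ proj₂ ∘ coded)
      λ x∈ y∈ same → CodeFor-unique (proj₂ (proj₂ (coded x∈))) (subst (CodeFor _) (sym same) (proj₂ (proj₂ (coded y∈))))
      where
      coded : ∀ {n} → n ∈ xs → ∃[ k ] k < N + Count × CodeFor n k
      coded n∈ = let n≤m , efficient = All.lookup members n∈ in codeFor n≤m efficient

    Count-small : ∀ c → 2 ^ (2 * (2 * c + A)) ≤ m → 2 * c * Count ≤ m
    Count-small c 2^≤m = begin
      2 * c * Count                     ≤⟨ *-mono-≤ (<⇒≤ (n<2^n (2 * c))) Count≤ ⟩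
      2 ^ (2 * c) * 2 ^ (A * u)         ≡⟨ ^-distribˡ-+-* 2 (2 * c) (A * u) ⟨
      2 ^ (2 * c + A * u)               ≤⟨ ^-monoʳ-≤ 2 budget ⟩
      2 ^ ℓ                             ≤⟨ 2^⌊log₂n⌋≤n m (≤-trans (m^n>0 2 (2 * (2 * c + A))) 2^≤m) ⟩
      m                                 ∎
      where
      open ≤-Reasoning
      X u : ℕ
      X = T * ⌊log₂ T ⌋
      u = 1 + X + K
      budget : 2 * c + A * u ≤ ℓ
      budget = exponent-budget c A X K ℓ
        (greatest-satisfies T-fits? (subst (λ z → 4 * z ≤ ℓ) (sym (*-zeroʳ A)) z≤n) ℓ)
        (greatest-satisfies K-fits? (subst (λ z → 4 * z ≤ ℓ) (sym (*-zeroʳ A)) z≤n) ℓ)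
        (2^j≤n⇒j≤⌊log₂n⌋ {2 * (2 * c + A)} 2^≤m)

mainTheorem4 : (R : ℕ) (f g : ℕ → ℕ) →
    LittleO-logOverLoglog f → LittleO-log g →
    DensityZero (λ n → ∃[ 𝒯 ] (All (λ τ → 1 ≤ τ × τ ≤ R) (TileSystem.temps 𝒯) ×
                               UniquelyAssemblesSquare 𝒯 n ×
                               TileSystem.t 𝒯 ≤ f n ×
                               length (TileSystem.temps 𝒯) ≤ g n))
mainTheorem4 R f g hf hg c = 2 * c * N + 2 ^ (2 * (2 * c + A)) , sparse
  where
  open Sparse R hf hg
  sparse : ∀ m → 2 * c * N + 2 ^ (2 * (2 * c + A)) ≤ m → ∀ xs → Unique xs →
           All (λ n → n ≤ m × EfficientlyAssembled R f g n) xs → c * length xs ≤ m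
  sparse m M≤m xs unique members = *-cancelˡ-≤ 2 (begin
    2 * (c * length xs)          ≤⟨ *-monoʳ-≤ 2 (*-monoʳ-≤ c (few-sizes unique members)) ⟩
    2 * (c * (N + Count))        ≡⟨ *-assoc 2 c (N + Count) ⟨
    2 * c * (N + Count)          ≡⟨ *-distribˡ-+ (2 * c) N Count ⟩
    2 * c * N + 2 * c * Count    ≤⟨ +-mono-≤ (m+n≤o⇒m≤o (2 * c * N) M≤m)
                                            (Count-small c (m+n≤o⇒n≤o (2 * c * N) M≤m)) ⟩
    m + m                        ≡⟨ cong (λ x → m + x) (+-identityʳ m) ⟨
    2 * m                        ∎)
    where
    open AtScale m
    open Code R T K using (Count)
    open ≤-Reasoning
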